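{- Let $a,b$ be positive integers and $t\ge a+2$, $s\ge b+2$. Let \[ M=\max\Big(R^{a+b+1}\big(HK^{(a+1)}_{t-1},TK^{(b+1)}_s\big),\ R^{a+b+1}\big(HK^{(a+1)}_t,TK^{(b+1)}_{s-1}\big)\Big). \] Then $R^{a+b+1}\big(HK^{(a+1)}_t,TK^{(b+1)}_s\big)\le M+t+b\binom{t}{a+1}-b$.
   Context: $K^{(m)}_n$ is the complete $m$-uniform hypergraph on $n$ vertices. For an $m$-uniform hypergraph $\mathcal{H}$ and $r\ge m$, the $r$-expansion $H\mathcal{H}$ is obtained by adding to each hyperedge $e$ a set $U_e$ of $r-m$ new vertices, the sets $U_e$ being pairwise disjoint and disjoint from $V(\mathcal{H})$; its hyperedges are $e\cup U_e$. For a hypergraph $\mathcal{H}'$ and $S\subseteq V(\mathcal{H}')$, $\mathrm{Tr}(\mathcal{H}',S)$ is the hypergraph on $S$ with hyperedges $\{h\cap S:h\in E(\mathcal{H}')\}$; $T\mathcal{H}$ is the set of $r$-uniform $\mathcal{H}'$ with $V(\mathcal{H})\subseteq V(\mathcal{H}')$ and $\mathrm{Tr}(\mathcal{H}',V(\mathcal{H}))=\mathcal{H}$. For collections $\mathcal{F}_1,\mathcal{F}_2$ of $r$-uniform hypergraphs, $R^r(\mathcal{F}_1,\mathcal{F}_2)$ is the least $N$ such that every 2-coloring of the hyperedges of the complete $r$-uniform hypergraph on $N$ vertices contains a subhypergraph of the first color isomorphic to a member of $\mathcal{F}_1$ or one of the second color isomorphic to a member of $\mathcal{F}_2$. Here $r=a+b+1$.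 -}

module Defs where

open import Data.Nat using (ℕ; zero; suc; _+_; _*_; _∸_; _≤_; _⊔_)
open import Data.Bool using (Bool; true; false)
open import Data.Fin using (Fin; quotient; _≟_)
open import Data.Fin.Subset using (Subset; outside; inside; _∪_; ∣_∣) renaming (_∈_ to _∈ₛ_)
open import Data.Vec as Vec using (Vec; []; _∷_; tabulate; lookup; replicate)
open import Data.List as List using (List; [_]; _++_; map; filter; length)
open import Data.List.Membership.Propositional using () renaming (_∈_ to _∈ₗ_)
open import Data.List.Relation.Unary.All using (All)
open import Data.Product using (Σ; Σ-syntax; ∃; ∃-syntax; _×_; _,_)
open import Data.Sum using (_⊎_)
open import Relation.Binary.PropositionalEquality using (_≡_)
open import Relation.Nullary.Decidable using (does)
open import Function.Definitions using (Injective)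
open import Data.Nat.Properties using () renaming (_≟_ to _≟ℕ_)

record Hyp : Set where
  constructor hyp
  field
    n : ℕ
    E : List (Subset n)
open Hyp public

Uniform : ℕ → Hyp → Set
Uniform r H = All (λ e → ∣ e ∣ ≡ r) (E H)

allSubsets : (n : ℕ) → List (Subset n)
allSubsets zero    = [ [] ]
allSubsets (suc n) = map (outside ∷_) (allSubsets n) ++ map (inside ∷_) (allSubsets n)

K : ℕ → ℕ → Hyp
K m t = hyp t (filter (λ e → ∣ e ∣ ≟ℕ m) (allSubsets t))

-- r-expansion of an m-uniform hypergraph H: vertices Fin (n + |E| * (r - m));
-- the k-th edge e_k gets the new block { n + k*(r-m) + j : j < r-m }.
Expansion : (r m : ℕ) → Hyp → Hyp
Expansion r m (hyp n es) =
  hyp (n + L * d) (List.tabulate {n = L} expEdge)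
  where
  L = length es
  d = r ∸ m
  expEdge : Fin L → Subset (n + L * d)
  expEdge k = (List.lookup es k Vec.++ replicate (L * d) outside)
              ∪ (replicate n outside Vec.++
                 tabulate (λ v → Data.Bool.if does (quotient d v ≟ k) then inside else outside))

HK : (r m t : ℕ) → Hyp → Set
HK r m t H' = H' ≡ Expansion r m (K m t)

Tr : {n n' : ℕ} → (Fin n → Fin n') → Subset n' → Subset n
Tr ι h = tabulate (λ i → lookup h (ι i))

-- T H (for r-uniform hypergraphs): r-uniform H' containing V(H) (via an injection ι)
-- whose trace on V(H) is exactly H (as a set of hyperedges).
T : (r : ℕ) → Hyp → Hyp → Set
T r H H' =
  Uniform r H' ×
  Σ[ ι ∈ (Fin (n H) → Fin (n H')) ]
    (Injective _≡_ _≡_ ι ×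
     (∀ h → h ∈ₗ E H' → Tr ι h ∈ₗ E H) ×
     (∀ e → e ∈ₗ E H → Σ[ h ∈ Subset (n H') ] (h ∈ₗ E H' × Tr ι h ≡ e)))

TK : (r m s : ℕ) → Hyp → Set
TK r m s = T r (K m s)

Image : {n N : ℕ} → (Fin n → Fin N) → Subset n → Subset N → Set
Image f e S = ∀ j → (j ∈ₛ S → Σ[ i ∈ _ ] (i ∈ₛ e × f i ≡ j)) × (Σ[ i ∈ _ ] (i ∈ₛ e × f i ≡ j) → j ∈ₛ S)

-- 2-colouring of the hyperedges of K^{(r)}_N (only values on r-subsets matter)
Colouring : ℕ → Set
Colouring N = Subset N → Bool

Copy : (r N : ℕ) → Colouring N → Bool → Hyp → Set
Copy r N c col H =
  Uniform r H ×
  Σ[ f ∈ (Fin (n H) → Fin N) ]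
    (Injective _≡_ _≡_ f ×
     (∀ e → e ∈ₗ E H → ∀ S → Image f e S → c S ≡ col))

Arrows : (r N : ℕ) → (Hyp → Set) → (Hyp → Set) → Set
Arrows r N F₁ F₂ = ∀ (c : Colouring N) →
  (Σ[ H ∈ Hyp ] (F₁ H × Copy r N c true H)) ⊎ (Σ[ H ∈ Hyp ] (F₂ H × Copy r N c false H))

IsRamsey : (r : ℕ) → (Hyp → Set) → (Hyp → Set) → ℕ → Set
IsRamsey r F₁ F₂ R = Arrows r R F₁ F₂ × (∀ N → Arrows r N F₁ F₂ → R ≤ N)

-- Colour the r-subsets of T ⊎ P, where r = a + b + 1, ∣T∣ = t and ∣P∣ = M + b (C(t, a+1) - 1).
-- Go through the (a+1)-subsets e of T in turn and pick for each a b-subset B of P, disjoint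
-- from the earlier choices, with e ∪ B red. If every e is served, the sets e ∪ B form a red
-- expansion of K^{(a+1)}_t. Otherwise some e is blocked while a set Q of at least m₂ unused
-- points remains, and e ∪ B is blue for every b-subset B of Q. By the Ramsey property of m₂,
-- Q carries a red expansion of K^{(a+1)}_t or a blue member H′ of T K^{(b+1)}_{s-1}. In the
-- latter case, adding a point of e as a new vertex and the blue sets e ∪ B, for B a b-subset
-- of the copy of K^{(b+1)}_{s-1} in H′, as new edges gives a blue member of T K^{(b+1)}_s.

module Submission where

open import Defs
open import Data.Nat using (ℕ; zero; suc; _+_; _*_; _∸_; _≤_; _<_; _⊔_; z≤n; s≤s)
open import Data.Nat.Properties
  using ( +-comm; +-suc; +-identityʳ; *-identityʳ; suc-injective; ≤-refl; ≤-trans; ≤-reflexive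
        ; m≤m+n; m≤n+m; m≤n⊔m; m≤n+m∸n; n≤1+n; +-monoˡ-≤; +-monoʳ-≤; *-monoʳ-≤; +-cancelˡ-≤
        ; +-∸-assoc; m+n∸m≡n; m+[n∸m]≡n; module ≤-Reasoning )
  renaming (_≟_ to _≟ℕ_)
open import Data.Nat.Tactic.RingSolver using (solve-∀)
open import Data.Nat.Combinatorics using (_C_; nCk+nC[k+1]≡[n+1]C[k+1])
open import Data.Bool using (Bool; true; false; _∨_; if_then_else_)
open import Data.Bool.Properties using (¬-not) renaming (_≟_ to _≟B_)
open import Data.Fin using (Fin; zero; suc; _↑ˡ_; _↑ʳ_; splitAt; quotient; remainder; combine; inject≤)
open import Data.Fin.Properties
  using ( any?; splitAt-↑ˡ; splitAt-↑ʳ; ↑ˡ-injective; ↑ʳ-injective; combine-remQuot; remQuot-combine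
        ; inject≤-injective )
  renaming (_≟_ to _≟F_; suc-injective to Fin-suc-injective)
open import Data.Fin.Subset using (Subset; outside; inside; ⊥; ⊤; _∪_; _─_; _⊆_; ⁅_⁆; ∣_∣; Nonempty)
  renaming (_∈_ to _∈ₛ_)
open import Data.Fin.Subset.Properties
  using ( ⊆-antisym; ∉⊥; ∣⊥∣≡0; ∣⊤∣≡n; x∈p∪q⁺; x∈p∪q⁻; x∈⁅x⁆; x∈⁅y⁆⇒x≡y; ∪-identityʳ; ∪-identityˡ
        ; ∪-comm; drop-∷-⊆; p─q⊆p; anySubset?; _⊆?_; _∈?_ )
open import Data.Vec using ([]; _∷_; _++_; lookup; tabulate; here; there)
open import Data.Vec.Properties
  using ( []=⇒lookup; lookup⇒[]=; lookup∘tabulate; zipWith-++; lookup-++ˡ; lookup-++ʳ; lookup-replicate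
        ; tabulate-cong )
open import Data.List as List using (List; map; filter; length)
open import Data.List.Properties using (filter-++; filter-none; length-++)
import Data.List.Relation.Unary.Any as Any
import Data.List.Relation.Unary.All as All
open import Data.List.Membership.Propositional using () renaming (_∈_ to _∈ₗ_)
import Data.List.Membership.Propositional.Properties as ∈ₗ
open import Data.Product using (Σ-syntax; ∃; _×_; _,_; proj₁; proj₂)
open import Data.Sum using (_⊎_; inj₁; inj₂; [_,_]′)
open import Data.Empty using (⊥-elim)
open import Function using (_∘_)
open import Function.Definitions using (Injective)
open import Relation.Binary.PropositionalEquality
  using (_≡_; _≢_; refl; sym; trans; cong; cong₂; subst; subst₂; module ≡-Reasoning)
open import Relation.Nullary using (Dec; yes; no; ¬_; contradiction)
open import Relation.Nullary.Decidable using (does; dec-true; _×-dec_)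
open import Relation.Unary using (Pred; Decidable)

witness : ∀ {ℓ} {A : Set ℓ} (a? : Dec A) → does a? ≡ true → A
witness (yes a) _ = a

∈-tabulate⁺ : ∀ {n} {f : Fin n → Bool} {i} → f i ≡ true → i ∈ₛ tabulate f
∈-tabulate⁺ {f = f} {i} fi = lookup⇒[]= i (tabulate f) (trans (lookup∘tabulate f i) fi)

∈-tabulate⁻ : ∀ {n} {f : Fin n → Bool} {i} → i ∈ₛ tabulate f → f i ≡ true
∈-tabulate⁻ {f = f} {i} i∈ = trans (sym (lookup∘tabulate f i)) ([]=⇒lookup i∈)

∈-++⁺ˡ : ∀ {m n} {p : Subset m} (q : Subset n) {i} → i ∈ₛ p → i ↑ˡ n ∈ₛ p ++ q
∈-++⁺ˡ q here       = here
∈-++⁺ˡ q (there i∈) = there (∈-++⁺ˡ q i∈)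

∈-++⁺ʳ : ∀ {m n} (p : Subset m) {q : Subset n} {i} → i ∈ₛ q → m ↑ʳ i ∈ₛ p ++ q
∈-++⁺ʳ []      i∈ = i∈
∈-++⁺ʳ (_ ∷ p) i∈ = there (∈-++⁺ʳ p i∈)

∈-++⁻ˡ : ∀ {m n} (p : Subset m) {q : Subset n} {i} → i ↑ˡ n ∈ₛ p ++ q → i ∈ₛ p
∈-++⁻ˡ (_ ∷ p) {i = zero}  here       = here
∈-++⁻ˡ (_ ∷ p) {i = suc i} (there i∈) = there (∈-++⁻ˡ p i∈)

∈-++⁻ʳ : ∀ {m n} (p : Subset m) {q : Subset n} {i} → m ↑ʳ i ∈ₛ p ++ q → i ∈ₛ q
∈-++⁻ʳ []      i∈         = i∈
∈-++⁻ʳ (_ ∷ p) (there i∈) = ∈-++⁻ʳ p i∈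

x∈p─q⇒x∉q : ∀ {n} (p q : Subset n) {x} → x ∈ₛ p ─ q → ¬ x ∈ₛ q
x∈p─q⇒x∉q (_ ∷ p) (inside ∷ q) ()         here
x∈p─q⇒x∉q (_ ∷ p) (_      ∷ q) (there x∈) (there x∈q) = x∈p─q⇒x∉q p q x∈ x∈q

0<∣p∣⇒Nonempty : ∀ {n} {p : Subset n} → 0 < ∣ p ∣ → Nonempty p
0<∣p∣⇒Nonempty {p = inside  ∷ p} _      = zero , here
0<∣p∣⇒Nonempty {p = outside ∷ p} 0<∣p∣ = let (x , x∈) = 0<∣p∣⇒Nonempty 0<∣p∣ in suc x , there x∈

∣p++q∣≡∣p∣+∣q∣ : ∀ {m n} (p : Subset m) (q : Subset n) → ∣ p ++ q ∣ ≡ ∣ p ∣ + ∣ q ∣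
∣p++q∣≡∣p∣+∣q∣ []            q = refl
∣p++q∣≡∣p∣+∣q∣ (inside  ∷ p) q = cong suc (∣p++q∣≡∣p∣+∣q∣ p q)
∣p++q∣≡∣p∣+∣q∣ (outside ∷ p) q = ∣p++q∣≡∣p∣+∣q∣ p q

∣p─q∣+∣q∣≡∣p∣ : ∀ {n} (p q : Subset n) → q ⊆ p → ∣ p ─ q ∣ + ∣ q ∣ ≡ ∣ p ∣
∣p─q∣+∣q∣≡∣p∣ []            []            _   = refl
∣p─q∣+∣q∣≡∣p∣ (outside ∷ p) (inside  ∷ q) q⊆p with () ← q⊆p here
∣p─q∣+∣q∣≡∣p∣ (inside  ∷ p) (inside  ∷ q) q⊆p =
  trans (+-suc _ _) (cong suc (∣p─q∣+∣q∣≡∣p∣ p q (drop-∷-⊆ q⊆p)))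
∣p─q∣+∣q∣≡∣p∣ (inside  ∷ p) (outside ∷ q) q⊆p = cong suc (∣p─q∣+∣q∣≡∣p∣ p q (drop-∷-⊆ q⊆p))
∣p─q∣+∣q∣≡∣p∣ (outside ∷ p) (outside ∷ q) q⊆p = ∣p─q∣+∣q∣≡∣p∣ p q (drop-∷-⊆ q⊆p)

∣p∪⁅x⁆∣≡1+∣p∣ : ∀ {n} (p : Subset n) {x} → ¬ x ∈ₛ p → ∣ p ∪ ⁅ x ⁆ ∣ ≡ suc ∣ p ∣
∣p∪⁅x⁆∣≡1+∣p∣ (inside  ∷ p) {zero}  x∉p = contradiction here x∉p
∣p∪⁅x⁆∣≡1+∣p∣ (outside ∷ p) {zero}  x∉p = cong suc (cong ∣_∣ (∪-identityʳ p))
∣p∪⁅x⁆∣≡1+∣p∣ (inside  ∷ p) {suc x} x∉p = cong suc (∣p∪⁅x⁆∣≡1+∣p∣ p (x∉p ∘ there))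
∣p∪⁅x⁆∣≡1+∣p∣ (outside ∷ p) {suc x} x∉p = ∣p∪⁅x⁆∣≡1+∣p∣ p (x∉p ∘ there)

++⊥∪⊥++ : ∀ {m n} (p : Subset m) (q : Subset n) → (p ++ ⊥) ∪ (⊥ ++ q) ≡ p ++ q
++⊥∪⊥++ p q = trans (zipWith-++ _∨_ p ⊥ ⊥ q) (cong₂ _++_ (∪-identityʳ p) (∪-identityˡ q))

image : ∀ {n N} → (Fin n → Fin N) → Subset n → Subset N
image f e = tabulate λ j → does (any? λ i → (i ∈? e) ×-dec (f i ≟F j))

module _ {n N} (f : Fin n → Fin N) where

  ∈-image⁺ : ∀ {e j} → (∃ λ i → i ∈ₛ e × f i ≡ j) → j ∈ₛ image f e
  ∈-image⁺ w = ∈-tabulate⁺ (dec-true (any? _) w)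

  ∈-image⁻ : ∀ {e j} → j ∈ₛ image f e → ∃ λ i → i ∈ₛ e × f i ≡ j
  ∈-image⁻ j∈ = witness (any? _) (∈-tabulate⁻ j∈)

  image≡ : ∀ e S → (∀ {i} → i ∈ₛ e → f i ∈ₛ S) → (∀ {j} → j ∈ₛ S → ∃ λ i → i ∈ₛ e × f i ≡ j) →
           image f e ≡ S
  image≡ e S into onto = ⊆-antisym
    (λ j∈ → let (i , i∈ , fi≡j) = ∈-image⁻ j∈ in subst (_∈ₛ S) fi≡j (into i∈))
    (∈-image⁺ ∘ onto)

  Image-image : ∀ e → Image f e (image f e)
  Image-image e j = ∈-image⁻ , ∈-image⁺

  Image⇒≡image : ∀ {e S} → Image f e S → S ≡ image f e
  Image⇒≡image {e} {S} im = sym (image≡ e S (λ i∈ → proj₂ (im _) (_ , i∈ , refl)) (proj₁ (im _)))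

  image-⊥ : image f ⊥ ≡ ⊥
  image-⊥ = image≡ ⊥ ⊥ (⊥-elim ∘ ∉⊥) (⊥-elim ∘ ∉⊥)

module _ {n N} (f : Fin (suc n) → Fin N) where

  image-outside∷ : ∀ e → image f (outside ∷ e) ≡ image (f ∘ suc) e
  image-outside∷ e = image≡ f (outside ∷ e) _
    (λ { (there i∈) → ∈-image⁺ (f ∘ suc) (_ , i∈ , refl) })
    (λ j∈ → let (i , i∈ , fi≡j) = ∈-image⁻ (f ∘ suc) j∈ in suc i , there i∈ , fi≡j)

  image-inside∷ : ∀ e → image f (inside ∷ e) ≡ image (f ∘ suc) e ∪ ⁅ f zero ⁆
  image-inside∷ e = image≡ f (inside ∷ e) _
    (λ { here       → x∈p∪q⁺ (inj₂ (x∈⁅x⁆ (f zero)))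
       ; (there i∈) → x∈p∪q⁺ (inj₁ (∈-image⁺ (f ∘ suc) (_ , i∈ , refl))) })
    (λ j∈ → [ (λ j∈′ → let (i , i∈ , fi≡j) = ∈-image⁻ (f ∘ suc) j∈′ in suc i , there i∈ , fi≡j)
            , (λ j∈⁅⁆ → zero , here , sym (x∈⁅y⁆⇒x≡y (f zero) j∈⁅⁆)) ]′ (x∈p∪q⁻ _ _ j∈))

∣image∣≡∣e∣ : ∀ {n N} {f : Fin n → Fin N} → Injective _≡_ _≡_ f → ∀ e → ∣ image f e ∣ ≡ ∣ e ∣
∣image∣≡∣e∣ {N = N} {f} _ [] = trans (cong ∣_∣ (image-⊥ f)) (∣⊥∣≡0 N)
∣image∣≡∣e∣ {f = f} f-inj (outside ∷ e) =
  trans (cong ∣_∣ (image-outside∷ f e)) (∣image∣≡∣e∣ (Fin-suc-injective ∘ f-inj) e)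
∣image∣≡∣e∣ {f = f} f-inj (inside ∷ e) = begin
  ∣ image f (inside ∷ e) ∣                   ≡⟨ cong ∣_∣ (image-inside∷ f e) ⟩
  ∣ image (f ∘ suc) e ∪ ⁅ f zero ⁆ ∣          ≡⟨ ∣p∪⁅x⁆∣≡1+∣p∣ _ f0∉ ⟩
  suc ∣ image (f ∘ suc) e ∣                   ≡⟨ cong suc (∣image∣≡∣e∣ (Fin-suc-injective ∘ f-inj) e) ⟩
  suc ∣ e ∣                                   ∎
  where
  open ≡-Reasoning
  f0∉ : ¬ f zero ∈ₛ image (f ∘ suc) e
  f0∉ f0∈ with () ← f-inj (proj₂ (proj₂ (∈-image⁻ (f ∘ suc) f0∈)))

module _ {n N} (ι : Fin n → Fin N) where

  ∈-Tr⁺ : ∀ {h i} → ι i ∈ₛ h → i ∈ₛ Tr ι h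
  ∈-Tr⁺ ιi∈ = ∈-tabulate⁺ ([]=⇒lookup ιi∈)

  ∈-Tr⁻ : ∀ {h i} → i ∈ₛ Tr ι h → ι i ∈ₛ h
  ∈-Tr⁻ {h} {i} i∈ = lookup⇒[]= (ι i) h (∈-tabulate⁻ i∈)

  Tr-image : Injective _≡_ _≡_ ι → ∀ B → Tr ι (image ι B) ≡ B
  Tr-image ι-injective B = ⊆-antisym
    (λ i∈ → let (i′ , i′∈ , ιi′≡ιi) = ∈-image⁻ ι (∈-Tr⁻ i∈)
            in subst (_∈ₛ B) (ι-injective ιi′≡ιi) i′∈)
    (λ i∈ → ∈-Tr⁺ (∈-image⁺ ι (_ , i∈ , refl)))

image-∘ : ∀ {n m N} (g : Fin m → Fin N) (f : Fin n → Fin m) e → image (g ∘ f) e ≡ image g (image f e)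
image-∘ g f e = image≡ (g ∘ f) e _
  (λ i∈ → ∈-image⁺ g (_ , ∈-image⁺ f (_ , i∈ , refl) , refl))
  (λ j∈ → let (y , y∈ , gy≡j) = ∈-image⁻ g j∈ ; (i , i∈ , fi≡y) = ∈-image⁻ f y∈
          in i , i∈ , trans (cong g fi≡y) gy≡j)

data SplitView (m n : ℕ) : Fin (m + n) → Set where
  left  : (i : Fin m) → SplitView m n (i ↑ˡ n)
  right : (j : Fin n) → SplitView m n (m ↑ʳ j)

splitView : ∀ m {n} (i : Fin (m + n)) → SplitView m n i
splitView zero    j       = right j
splitView (suc m) zero    = left zero
splitView (suc m) (suc i) with splitView m i
... | left  i′ = left (suc i′)
... | right j  = right j

↑ˡ≢↑ʳ : ∀ {m n} (i : Fin m) (j : Fin n) → i ↑ˡ n ≢ m ↑ʳ j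
↑ˡ≢↑ʳ {m} {n} i j eq
  with () ← trans (sym (splitAt-↑ˡ m i n)) (trans (cong (splitAt m) eq) (splitAt-↑ʳ m n j))

copair : ∀ {m n N} → (Fin m → Fin N) → (Fin n → Fin N) → Fin (m + n) → Fin N
copair {m} F G i = [ F , G ]′ (splitAt m i)

module _ {m n N} (F : Fin m → Fin N) (G : Fin n → Fin N) where

  copair-↑ˡ : ∀ i → copair F G (i ↑ˡ n) ≡ F i
  copair-↑ˡ i = cong [ F , G ]′ (splitAt-↑ˡ m i n)

  copair-↑ʳ : ∀ j → copair F G (m ↑ʳ j) ≡ G j
  copair-↑ʳ j = cong [ F , G ]′ (splitAt-↑ʳ m n j)

  copair-injective : Injective _≡_ _≡_ F → Injective _≡_ _≡_ G → (∀ i j → F i ≢ G j) →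
                     Injective _≡_ _≡_ (copair F G)
  copair-injective F-inj G-inj F≢G {x} {y} eq with splitView m x | splitView m y
  ... | left i  | left i′  = cong (_↑ˡ n) (F-inj (trans (sym (copair-↑ˡ i)) (trans eq (copair-↑ˡ i′))))
  ... | left i  | right j  = ⊥-elim (F≢G i j (trans (sym (copair-↑ˡ i)) (trans eq (copair-↑ʳ j))))
  ... | right j | left i   = ⊥-elim (F≢G i j (trans (sym (copair-↑ˡ i)) (trans (sym eq) (copair-↑ʳ j))))
  ... | right j | right j′ = cong (m ↑ʳ_) (G-inj (trans (sym (copair-↑ʳ j)) (trans eq (copair-↑ʳ j′))))

  image-copair : ∀ p q → image (copair F G) (p ++ q) ≡ image F p ∪ image G q
  image-copair p q = image≡ (copair F G) (p ++ q) _ into onto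
    where
    into : ∀ {x} → x ∈ₛ p ++ q → copair F G x ∈ₛ image F p ∪ image G q
    into {x} x∈ with splitView m x
    ... | left i  = x∈p∪q⁺ (inj₁ (∈-image⁺ F (i , ∈-++⁻ˡ p x∈ , sym (copair-↑ˡ i))))
    ... | right j = x∈p∪q⁺ (inj₂ (∈-image⁺ G (j , ∈-++⁻ʳ p x∈ , sym (copair-↑ʳ j))))
    onto : ∀ {y} → y ∈ₛ image F p ∪ image G q → ∃ λ x → x ∈ₛ p ++ q × copair F G x ≡ y
    onto y∈ with x∈p∪q⁻ (image F p) (image G q) y∈
    ... | inj₁ y∈F = let (i , i∈ , Fi≡y) = ∈-image⁻ F y∈F
                     in i ↑ˡ n , ∈-++⁺ˡ q i∈ , trans (copair-↑ˡ i) Fi≡y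
    ... | inj₂ y∈G = let (j , j∈ , Gj≡y) = ∈-image⁻ G y∈G
                     in m ↑ʳ j , ∈-++⁺ʳ p j∈ , trans (copair-↑ʳ j) Gj≡y

image-↑ˡ : ∀ {m} n (e : Subset m) → image (_↑ˡ n) e ≡ e ++ ⊥
image-↑ˡ {m} n e = image≡ (_↑ˡ n) e (e ++ ⊥) (∈-++⁺ˡ ⊥) onto
  where
  onto : ∀ {y} → y ∈ₛ e ++ ⊥ → ∃ λ i → i ∈ₛ e × i ↑ˡ n ≡ y
  onto {y} y∈ with splitView m y
  ... | left i  = i , ∈-++⁻ˡ e y∈ , refl
  ... | right j = ⊥-elim (∉⊥ (∈-++⁻ʳ e y∈))

image-↑ʳ : ∀ m {n} (e : Subset n) → image (m ↑ʳ_) e ≡ ⊥ ++ e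
image-↑ʳ m e = image≡ (m ↑ʳ_) e (⊥ ++ e) (∈-++⁺ʳ ⊥) onto
  where
  onto : ∀ {y} → y ∈ₛ ⊥ ++ e → ∃ λ j → j ∈ₛ e × m ↑ʳ j ≡ y
  onto {y} y∈ with splitView m y
  ... | left i  = ⊥-elim (∉⊥ (∈-++⁻ˡ ⊥ y∈))
  ... | right j = j , ∈-++⁻ʳ ⊥ y∈ , refl

Copy-intro : ∀ {r N} {c : Colouring N} {col H} (f : Fin (n H) → Fin N) →
  Uniform r H → Injective _≡_ _≡_ f → (∀ e → e ∈ₗ E H → c (image f e) ≡ col) → Copy r N c col H
Copy-intro {c = c} f uniform f-inj coloured =
  uniform , f , f-inj , λ e e∈ S im → trans (cong c (Image⇒≡image f im)) (coloured e e∈)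

Copy-pullback : ∀ {r m N} {c : Colouring N} {col H} (q : Fin m → Fin N) → Injective _≡_ _≡_ q →
  Copy r m (c ∘ image q) col H → Copy r N c col H
Copy-pullback {c = c} q q-inj (uniform , f , f-inj , coloured) =
  Copy-intro (q ∘ f) uniform (f-inj ∘ q-inj)
    λ e e∈ → trans (cong c (image-∘ q f e)) (coloured e e∈ (image f e) (Image-image f e))

record Enumeration {n} (Q : Subset n) (k : ℕ) : Set where
  field
    element   : Fin k → Fin n
    injective : Injective _≡_ _≡_ element
    sound     : ∀ x → element x ∈ₛ Q
    complete  : ∀ {y} → y ∈ₛ Q → ∃ λ x → element x ≡ y

enumerate : ∀ {n} (Q : Subset n) → Enumeration Q ∣ Q ∣
enumerate [] = record { element = λ () ; injective = λ { {()} } ; sound = λ () ; complete = λ () }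
enumerate (outside ∷ Q) = record
  { element   = suc ∘ element
  ; injective = injective ∘ Fin-suc-injective
  ; sound     = there ∘ sound
  ; complete  = λ { (there y∈) → let (x , eq) = complete y∈ in x , cong suc eq }
  }
  where open Enumeration (enumerate Q)
enumerate (inside ∷ Q) = record
  { element   = λ { zero → zero ; (suc x) → suc (element x) }
  ; injective = λ { {zero} {zero} _ → refl ; {suc x} {suc y} eq → cong suc (injective (Fin-suc-injective eq)) }
  ; sound     = λ { zero → here ; (suc x) → there (sound x) }
  ; complete  = λ { here → zero , refl ; (there y∈) → let (x , eq) = complete y∈ in suc x , cong suc eq }
  }
  where open Enumeration (enumerate Q)

∈-allSubsets : ∀ n (e : Subset n) → e ∈ₗ allSubsets n
∈-allSubsets zero    []            = Any.here refl
∈-allSubsets (suc n) (outside ∷ e) = ∈ₗ.∈-++⁺ˡ (∈ₗ.∈-map⁺ (outside ∷_) (∈-allSubsets n e))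
∈-allSubsets (suc n) (inside  ∷ e) =
  ∈ₗ.∈-++⁺ʳ (map (outside ∷_) (allSubsets n)) (∈ₗ.∈-map⁺ (inside ∷_) (∈-allSubsets n e))

module _ {m n : ℕ} {e : Subset n} where

  ∈-K⁺ : ∣ e ∣ ≡ m → e ∈ₗ E (K m n)
  ∈-K⁺ = ∈ₗ.∈-filter⁺ (λ e → ∣ e ∣ ≟ℕ m) (∈-allSubsets n e)

  ∈-K⁻ : e ∈ₗ E (K m n) → ∣ e ∣ ≡ m
  ∈-K⁻ e∈ = proj₂ (∈ₗ.∈-filter⁻ (λ e → ∣ e ∣ ≟ℕ m) {xs = allSubsets n} e∈)

K-uniform : ∀ m n → Uniform m (K m n)
K-uniform m n = All.tabulate ∈-K⁻

module _ {a b p q} {A : Set a} {B : Set b} {P : Pred B p} {Q : Pred A q} where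

  length-filter-map : (P? : Decidable P) (Q? : Decidable Q) (f : A → B) →
    (∀ x → does (P? (f x)) ≡ does (Q? x)) → ∀ xs → length (filter P? (map f xs)) ≡ length (filter Q? xs)
  length-filter-map P? Q? f P∘f≡Q List.[] = refl
  length-filter-map P? Q? f P∘f≡Q (x List.∷ xs) with does (P? (f x)) | does (Q? x) | P∘f≡Q x
  ... | false | false | refl = length-filter-map P? Q? f P∘f≡Q xs
  ... | true  | true  | refl = cong suc (length-filter-map P? Q? f P∘f≡Q xs)

length-E-K-suc : ∀ m n → length (E (K m (suc n))) ≡
  length (E (K m n)) + length (filter (λ e → ∣ e ∣ ≟ℕ m) (map (inside ∷_) (allSubsets n)))
length-E-K-suc m n = begin
  length (filter P? (map (outside ∷_) A List.++ map (inside ∷_) A))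
    ≡⟨ cong length (filter-++ P? (map (outside ∷_) A) _) ⟩
  length (filter P? (map (outside ∷_) A) List.++ filter P? (map (inside ∷_) A))
    ≡⟨ length-++ (filter P? (map (outside ∷_) A)) ⟩
  length (filter P? (map (outside ∷_) A)) + length (filter P? (map (inside ∷_) A))
    ≡⟨ cong (_+ length (filter P? (map (inside ∷_) A))) (length-filter-map P? P? (outside ∷_) (λ _ → refl) A) ⟩
  length (filter P? A) + length (filter P? (map (inside ∷_) A)) ∎
  where
  open ≡-Reasoning
  A = allSubsets n
  P? = λ {k} (e : Subset k) → ∣ e ∣ ≟ℕ m

length-E-K : ∀ m n → length (E (K m n)) ≡ n C m
length-E-K zero    zero    = refl
length-E-K (suc m) zero    = refl
length-E-K zero    (suc n) = trans (length-E-K-suc 0 n)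
  (cong₂ _+_ (length-E-K 0 n) (trans (length-filter-map _ (λ _ → 1 ≟ℕ 0) (inside ∷_) (λ _ → refl) A)
                                     (cong length (filter-none _ (All.universal (λ _ ()) A)))))
  where A = allSubsets n
length-E-K (suc m) (suc n) = begin
  length (E (K (suc m) (suc n)))
    ≡⟨ length-E-K-suc (suc m) n ⟩
  length (E (K (suc m) n)) + length (filter (λ e → ∣ e ∣ ≟ℕ suc m) (map (inside ∷_) A))
    ≡⟨ cong₂ _+_ (length-E-K (suc m) n)
                 (length-filter-map _ (λ e → ∣ e ∣ ≟ℕ m) (inside ∷_) (λ _ → refl) A) ⟩
  n C suc m + length (E (K m n))
    ≡⟨ cong (n C suc m +_) (length-E-K m n) ⟩
  n C suc m + n C m
    ≡⟨ +-comm (n C suc m) (n C m) ⟩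
  n C m + n C suc m
    ≡⟨ nCk+nC[k+1]≡[n+1]C[k+1] n m ⟩
  suc n C suc m ∎
  where
  open ≡-Reasoning
  A = allSubsets n

C-positive : ∀ {n k} → k ≤ n → 1 ≤ n C k
C-positive z≤n = ≤-refl
C-positive {suc n} {suc k} (s≤s k≤n) = begin
  1                 ≤⟨ C-positive k≤n ⟩
  n C k             ≤⟨ m≤m+n (n C k) (n C suc k) ⟩
  n C k + n C suc k ≡⟨ nCk+nC[k+1]≡[n+1]C[k+1] n k ⟩
  suc n C suc k     ∎
  where open ≤-Reasoning

PairwiseDisjoint : ∀ {k P} → (Fin k → Subset P) → Set
PairwiseDisjoint U = ∀ i j {y} → y ∈ₛ U i → y ∈ₛ U j → i ≡ j

DisjointChoice : ∀ {k P} (d : ℕ) (χ : Fin k → Subset P → Bool) (pool : Subset P) → Set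
DisjointChoice {k} {P} d χ pool = Σ[ U ∈ (Fin k → Subset P) ]
  (∀ i → U i ⊆ pool) × (∀ i → ∣ U i ∣ ≡ d) × PairwiseDisjoint U × (∀ i → χ i (U i) ≡ true)

Blocked : ∀ {k P} (d m : ℕ) (χ : Fin k → Subset P → Bool) → Set
Blocked {k} {P} d m χ = Σ[ i ∈ Fin k ] Σ[ Q ∈ Subset P ]
  m ≤ ∣ Q ∣ × (∀ B → B ⊆ Q → ∣ B ∣ ≡ d → χ i B ≡ false)

DisjointChoice-∷ : ∀ {k P d} {χ : Fin (suc k) → Subset P → Bool} {pool B} →
  B ⊆ pool → ∣ B ∣ ≡ d → χ zero B ≡ true → DisjointChoice d (χ ∘ suc) (pool ─ B) → DisjointChoice d χ pool
DisjointChoice-∷ {k} {P} {d} {χ} {pool} {B} B⊆ ∣B∣≡d χB (U , U⊆ , ∣U∣≡d , disjoint , χU) =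
  U′ , U′⊆ , ∣U′∣≡d , disjoint′ , χU′
  where
  U′ : Fin (suc k) → Subset P
  U′ zero    = B
  U′ (suc i) = U i
  U′⊆ : ∀ i → U′ i ⊆ pool
  U′⊆ zero    = B⊆
  U′⊆ (suc i) = p─q⊆p pool B ∘ U⊆ i
  ∣U′∣≡d : ∀ i → ∣ U′ i ∣ ≡ d
  ∣U′∣≡d zero    = ∣B∣≡d
  ∣U′∣≡d (suc i) = ∣U∣≡d i
  disjoint′ : PairwiseDisjoint U′
  disjoint′ zero    zero    _   _   = refl
  disjoint′ zero    (suc j) y∈B y∈U = ⊥-elim (x∈p─q⇒x∉q pool B (U⊆ j y∈U) y∈B)
  disjoint′ (suc i) zero    y∈U y∈B = ⊥-elim (x∈p─q⇒x∉q pool B (U⊆ i y∈U) y∈B)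
  disjoint′ (suc i) (suc j) y∈U y∈U′ = cong suc (disjoint i j y∈U y∈U′)
  χU′ : ∀ i → χ i (U′ i) ≡ true
  χU′ zero    = χB
  χU′ (suc i) = χU i

room-step : ∀ {m d k x} → m + d * suc k ≤ d + x → m + d * k ≤ x
room-step {m} {d} {k} {x} room = +-cancelˡ-≤ d (m + d * k) x (≤-trans (≤-reflexive (rearrange m d k)) room)
  where
  rearrange : ∀ m d k → d + (m + d * k) ≡ m + d * suc k
  rearrange = solve-∀

-- The bound on the pool reads ∣ pool ∣ ≥ m + d (k - 1) without truncated subtraction; it
-- leaves at least m points for whichever index gets blocked.
greedy : ∀ {P} d m k (χ : Fin k → Subset P → Bool) pool →
  m + d * k ≤ d + ∣ pool ∣ → Blocked d m χ ⊎ DisjointChoice d χ pool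
greedy d m zero    χ pool _ = inj₂ ((λ ()) , (λ ()) , (λ ()) , (λ ()) , (λ ()))
greedy d m (suc k) χ pool room
  with anySubset? (λ B → B ⊆? pool ×-dec (∣ B ∣ ≟ℕ d ×-dec χ zero B ≟B true))
... | no none = inj₁ (zero , pool , ≤-trans (m≤m+n m (d * k)) (room-step room) ,
                      λ B B⊆ ∣B∣≡d → ¬-not (λ χB → none (B , B⊆ , ∣B∣≡d , χB)))
... | yes (B , B⊆ , ∣B∣≡d , χB) with greedy d m k (χ ∘ suc) (pool ─ B) room′
  where
  room′ : m + d * k ≤ d + ∣ pool ─ B ∣
  room′ = ≤-trans (room-step room) (≤-reflexive (trans
            (sym (∣p─q∣+∣q∣≡∣p∣ pool B B⊆)) (trans (cong (∣ pool ─ B ∣ +_) ∣B∣≡d) (+-comm _ d))))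
... | inj₁ (i , blocked)  = inj₁ (suc i , blocked)
... | inj₂ choice         = inj₂ (DisjointChoice-∷ {χ = χ} B⊆ ∣B∣≡d χB choice)

-- The i-th block of new vertices of an expansion, spelled exactly as in Expansion.
block : ∀ {L} d → Fin L → Subset (L * d)
block d i = tabulate λ v → if does (quotient d v ≟F i) then inside else outside

∈-block⁺ : ∀ {L d i v} → quotient {L} d v ≡ i → v ∈ₛ block d i
∈-block⁺ {d = d} {i} {v} q≡i =
  ∈-tabulate⁺ (cong (λ b → if b then inside else outside) (dec-true (quotient d v ≟F i) q≡i))

∈-block⁻ : ∀ {L d i v} → v ∈ₛ block {L} d i → quotient d v ≡ i
∈-block⁻ {d = d} {i} {v} v∈ with quotient d v ≟F i | ∈-tabulate⁻ v∈
... | yes q≡i | _ = q≡i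

module Scatter {L d P} (U : Fin L → Subset P) (∣U∣≡d : ∀ i → ∣ U i ∣ ≡ d) (disjoint : PairwiseDisjoint U)
  where

  enum : ∀ i → Enumeration (U i) d
  enum i = subst (Enumeration (U i)) (∣U∣≡d i) (enumerate (U i))

  open module Enum i = Enumeration (enum i)

  element-injective : ∀ {i j x y} → element i x ≡ element j y → i ≡ j × x ≡ y
  element-injective {i} {j} {x} eq with disjoint i j (sound i x) (subst (_∈ₛ U j) (sym eq) (sound j _))
  ... | refl = refl , injective i eq

  scatter : Fin (L * d) → Fin P
  scatter v = element (quotient {L} d v) (remainder {L} d v)

  scatter-injective : Injective _≡_ _≡_ scatter
  scatter-injective {v} {v′} eq with element-injective eq
  ... | q≡q′ , r≡r′ = begin
    v                                              ≡⟨ combine-remQuot {L} d v ⟨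
    combine (quotient {L} d v) (remainder {L} d v)   ≡⟨ cong₂ combine q≡q′ r≡r′ ⟩
    combine (quotient {L} d v′) (remainder {L} d v′) ≡⟨ combine-remQuot {L} d v′ ⟩
    v′                                             ∎
    where open ≡-Reasoning

  image-scatter-block : ∀ i → image scatter (block d i) ≡ U i
  image-scatter-block i = image≡ scatter (block d i) (U i)
    (λ {v} v∈ → subst (λ j → scatter v ∈ₛ U j) (∈-block⁻ v∈) (sound _ (remainder {L} d v)))
    (λ y∈ → let (x , eq) = complete i y∈ ; rq≡ = remQuot-combine {L} {d} i x
            in combine i x , ∈-block⁺ (cong proj₁ rq≡) ,
               trans (cong (λ p → element (proj₁ p) (proj₂ p)) rq≡) eq)

  ∣block∣≡d : ∀ i → ∣ block d i ∣ ≡ d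
  ∣block∣≡d i = trans (sym (∣image∣≡∣e∣ scatter-injective (block d i)))
                      (trans (cong ∣_∣ (image-scatter-block i)) (∣U∣≡d i))

expansion-copy : ∀ {r k t P pool} {c : Colouring (t + P)} (es : List (Subset t)) →
  k ≤ r → Uniform k (hyp t es) → DisjointChoice (r ∸ k) (λ i B → c (List.lookup es i ++ B)) pool →
  Copy r (t + P) c true (Expansion r k (hyp t es))
expansion-copy {r} {k} {t} {P} {c = c} es k≤r es-uniform (U , _ , ∣U∣≡d , disjoint , red) =
  Copy-intro f (All.tabulate edge-uniform) f-injective edge-red
  where
  open Scatter U ∣U∣≡d disjoint
  d = r ∸ k
  e = List.lookup es

  f : Fin (t + length es * d) → Fin (t + P)
  f = copair (_↑ˡ P) ((t ↑ʳ_) ∘ scatter)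

  f-injective : Injective _≡_ _≡_ f
  f-injective = copair-injective _ _ (↑ˡ-injective P _ _) (scatter-injective ∘ ↑ʳ-injective t _ _)
                                 (λ i v → ↑ˡ≢↑ʳ i (scatter v))

  edge : ∀ {h} → h ∈ₗ E (Expansion r k (hyp t es)) → ∃ λ i → h ≡ e i ++ block d i
  edge h∈ = let (i , h≡) = ∈ₗ.∈-tabulate⁻ h∈ in i , trans h≡ (++⊥∪⊥++ (e i) (block d i))

  edge-uniform : ∀ {h} → h ∈ₗ E (Expansion r k (hyp t es)) → ∣ h ∣ ≡ r
  edge-uniform h∈ with edge h∈
  ... | i , refl = begin
    ∣ e i ++ block d i ∣         ≡⟨ ∣p++q∣≡∣p∣+∣q∣ (e i) (block d i) ⟩
    ∣ e i ∣ + ∣ block d i ∣      ≡⟨ cong₂ _+_ (All.lookup es-uniform (∈ₗ.∈-lookup i)) (∣block∣≡d i) ⟩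
    k + (r ∸ k)                  ≡⟨ m+[n∸m]≡n k≤r ⟩
    r                            ∎
    where open ≡-Reasoning

  edge-red : ∀ h → h ∈ₗ E (Expansion r k (hyp t es)) → c (image f h) ≡ true
  edge-red h h∈ with edge h∈
  ... | i , refl = trans (cong c image-edge) (red i)
    where
    open ≡-Reasoning
    image-edge : image f (e i ++ block d i) ≡ e i ++ U i
    image-edge = begin
      image f (e i ++ block d i)
        ≡⟨ image-copair _ _ (e i) (block d i) ⟩
      image (_↑ˡ P) (e i) ∪ image ((t ↑ʳ_) ∘ scatter) (block d i)
        ≡⟨ cong₂ _∪_ (image-↑ˡ P (e i)) (image-∘ (t ↑ʳ_) scatter (block d i)) ⟩
      (e i ++ ⊥) ∪ image (t ↑ʳ_) (image scatter (block d i))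
        ≡⟨ cong ((e i ++ ⊥) ∪_) (trans (image-↑ʳ t _) (cong (⊥ ++_) (image-scatter-block i))) ⟩
      (e i ++ ⊥) ∪ (⊥ ++ U i)
        ≡⟨ ++⊥∪⊥++ (e i) (U i) ⟩
      e i ++ U i ∎

module Cone {r b s t : ℕ} (H′ : Hyp) (H′∈TK : TK r (b + 1) s H′) (e : Subset t) where

  ι : Fin s → Fin (n H′)
  ι = proj₁ (proj₂ H′∈TK)

  ι-injective : Injective _≡_ _≡_ ι
  ι-injective = proj₁ (proj₂ (proj₂ H′∈TK))

  traces-of-H′ : ∀ h → h ∈ₗ E H′ → Tr ι h ∈ₗ E (K (b + 1) s)
  traces-of-H′ = proj₁ (proj₂ (proj₂ (proj₂ H′∈TK)))

  edges-of-H′ : ∀ e₀ → e₀ ∈ₗ E (K (b + 1) s) → Σ[ h ∈ Subset (n H′) ] (h ∈ₗ E H′ × Tr ι h ≡ e₀)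
  edges-of-H′ = proj₂ (proj₂ (proj₂ (proj₂ H′∈TK)))

  cone : Hyp
  cone = hyp (n H′ + t) (map (_++ ⊥) (E H′) List.++ map (λ B → image ι B ++ e) (E (K b s)))

  data ConeEdge : Subset (n H′ + t) → Set where
    old : ∀ {h} → h ∈ₗ E H′ → ConeEdge (h ++ ⊥)
    new : ∀ {B} → ∣ B ∣ ≡ b → ConeEdge (image ι B ++ e)

  coneEdge : ∀ {h} → h ∈ₗ E cone → ConeEdge h
  coneEdge h∈ with ∈ₗ.∈-++⁻ (map (_++ ⊥) (E H′)) h∈
  ... | inj₁ h∈old with ∈ₗ.∈-map⁻ (_++ ⊥) h∈old
  ...   | _ , h∈ , refl = old h∈
  coneEdge h∈ | inj₂ h∈new with ∈ₗ.∈-map⁻ (λ B → image ι B ++ e) h∈new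
  ...   | _ , B∈ , refl = new (∈-K⁻ B∈)

  module _ (b+∣e∣≡r : b + ∣ e ∣ ≡ r) where

    cone-uniform : Uniform r cone
    cone-uniform = All.tabulate (size ∘ coneEdge)
      where
      size : ∀ {h} → ConeEdge h → ∣ h ∣ ≡ r
      size (old {h} h∈) = begin
        ∣ h ++ ⊥ ∣           ≡⟨ ∣p++q∣≡∣p∣+∣q∣ h ⊥ ⟩
        ∣ h ∣ + ∣ ⊥ {t} ∣     ≡⟨ cong (∣ h ∣ +_) (∣⊥∣≡0 t) ⟩
        ∣ h ∣ + 0             ≡⟨ +-identityʳ ∣ h ∣ ⟩
        ∣ h ∣                 ≡⟨ All.lookup (proj₁ H′∈TK) h∈ ⟩
        r                     ∎
        where open ≡-Reasoning
      size (new {B} ∣B∣≡b) = begin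
        ∣ image ι B ++ e ∣        ≡⟨ ∣p++q∣≡∣p∣+∣q∣ (image ι B) e ⟩
        ∣ image ι B ∣ + ∣ e ∣     ≡⟨ cong (_+ ∣ e ∣) (trans (∣image∣≡∣e∣ ι-injective B) ∣B∣≡b) ⟩
        b + ∣ e ∣                 ≡⟨ b+∣e∣≡r ⟩
        r                         ∎
        where open ≡-Reasoning

    -- The new vertex of K^{(b+1)}_{s+1} is a point x₀ of e: old edges miss it, new edges contain it.
    cone-TK : ∀ {x₀} → x₀ ∈ₛ e → TK r (b + 1) (suc s) cone
    cone-TK {x₀} x₀∈e = cone-uniform , ι′ , ι′-injective , trace , cover
      where
      ι′ : Fin (suc s) → Fin (n H′ + t)
      ι′ zero    = n H′ ↑ʳ x₀
      ι′ (suc j) = ι j ↑ˡ t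

      ι′-injective : Injective _≡_ _≡_ ι′
      ι′-injective {zero}  {zero}  _  = refl
      ι′-injective {zero}  {suc j} eq with () ← ↑ˡ≢↑ʳ (ι j) x₀ (sym eq)
      ι′-injective {suc i} {zero}  eq with () ← ↑ˡ≢↑ʳ (ι i) x₀ eq
      ι′-injective {suc i} {suc j} eq = cong suc (ι-injective (↑ˡ-injective t _ _ eq))

      Tr-old : ∀ h → Tr ι′ (h ++ ⊥) ≡ outside ∷ Tr ι h
      Tr-old h = cong₂ _∷_ (trans (lookup-++ʳ h ⊥ x₀) (lookup-replicate x₀ outside))
                           (tabulate-cong (λ j → lookup-++ˡ h ⊥ (ι j)))

      Tr-new : ∀ B → Tr ι′ (image ι B ++ e) ≡ inside ∷ B
      Tr-new B = cong₂ _∷_ (trans (lookup-++ʳ (image ι B) e x₀) ([]=⇒lookup x₀∈e))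
                           (trans (tabulate-cong (λ j → lookup-++ˡ (image ι B) e (ι j)))
                                  (Tr-image ι ι-injective B))

      trace : ∀ h → h ∈ₗ E cone → Tr ι′ h ∈ₗ E (K (b + 1) (suc s))
      trace _ h∈ with coneEdge h∈
      ... | old {h} h∈′   = ∈-K⁺ (trans (cong ∣_∣ (Tr-old h)) (∈-K⁻ (traces-of-H′ h h∈′)))
      ... | new {B} ∣B∣≡b = ∈-K⁺ (trans (cong ∣_∣ (Tr-new B)) (trans (cong suc ∣B∣≡b) (+-comm 1 b)))

      cover : ∀ e′ → e′ ∈ₗ E (K (b + 1) (suc s)) → Σ[ h ∈ Subset (n H′ + t) ] (h ∈ₗ E cone × Tr ι′ h ≡ e′)
      cover (outside ∷ e₀) e′∈ =
        let (h , h∈ , Trh≡e₀) = edges-of-H′ e₀ (∈-K⁺ (∈-K⁻ e′∈))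
        in h ++ ⊥ , ∈ₗ.∈-++⁺ˡ (∈ₗ.∈-map⁺ (_++ ⊥) h∈) , trans (Tr-old h) (cong (outside ∷_) Trh≡e₀)
      cover (inside ∷ e₀) e′∈ =
        image ι e₀ ++ e , ∈ₗ.∈-++⁺ʳ (map (_++ ⊥) (E H′)) (∈ₗ.∈-map⁺ _ (∈-K⁺ ∣e₀∣≡b)) , Tr-new e₀
        where
        ∣e₀∣≡b : ∣ e₀ ∣ ≡ b
        ∣e₀∣≡b = suc-injective (trans (∈-K⁻ e′∈) (+-comm b 1))

    cone-Copy : ∀ {m P} {c : Colouring (t + P)} (g : Fin m → Fin P) → Injective _≡_ _≡_ g →
      (∀ B → ∣ B ∣ ≡ b → c (e ++ image g B) ≡ false) →
      Copy r m (c ∘ image ((t ↑ʳ_) ∘ g)) false H′ → Copy r (t + P) c false cone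
    cone-Copy {P = P} {c} g g-injective blue (_ , f , f-injective , blue-H′) =
      Copy-intro F cone-uniform F-injective (λ h h∈ → blue-edge (coneEdge h∈))
      where
      q = (t ↑ʳ_) ∘ g

      F : Fin (n H′ + t) → Fin (t + P)
      F = copair (q ∘ f) (_↑ˡ P)

      F-injective : Injective _≡_ _≡_ F
      F-injective = copair-injective _ _ (f-injective ∘ g-injective ∘ ↑ʳ-injective t _ _)
                                     (↑ˡ-injective P _ _) (λ y i → ↑ˡ≢↑ʳ i (g (f y)) ∘ sym)

      blue-edge : ∀ {h} → ConeEdge h → c (image F h) ≡ false
      blue-edge (old {h} h∈) = trans (cong c image-old) (blue-H′ h h∈ (image f h) (Image-image f h))
        where
        open ≡-Reasoning
        image-old : image F (h ++ ⊥) ≡ image q (image f h)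
        image-old = begin
          image F (h ++ ⊥)                        ≡⟨ image-copair _ _ h ⊥ ⟩
          image (q ∘ f) h ∪ image (_↑ˡ P) ⊥       ≡⟨ cong₂ _∪_ (image-∘ q f h) (image-⊥ (_↑ˡ P)) ⟩
          image q (image f h) ∪ ⊥                 ≡⟨ ∪-identityʳ _ ⟩
          image q (image f h)                     ∎
      blue-edge (new {B} ∣B∣≡b) = trans (cong c image-new) (blue Y ∣Y∣≡b)
        where
        open ≡-Reasoning
        Y = image f (image ι B)
        ∣Y∣≡b : ∣ Y ∣ ≡ b
        ∣Y∣≡b = trans (∣image∣≡∣e∣ f-injective _) (trans (∣image∣≡∣e∣ ι-injective B) ∣B∣≡b)
        image-new : image F (image ι B ++ e) ≡ e ++ image g Y
        image-new = begin
          image F (image ι B ++ e)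
            ≡⟨ image-copair _ _ (image ι B) e ⟩
          image (q ∘ f) (image ι B) ∪ image (_↑ˡ P) e
            ≡⟨ cong₂ _∪_ (trans (image-∘ q f _) (image-∘ (t ↑ʳ_) g Y)) (image-↑ˡ P e) ⟩
          image (t ↑ʳ_) (image g Y) ∪ (e ++ ⊥)
            ≡⟨ cong (_∪ (e ++ ⊥)) (image-↑ʳ t (image g Y)) ⟩
          (⊥ ++ image g Y) ∪ (e ++ ⊥)
            ≡⟨ ∪-comm (⊥ ++ image g Y) (e ++ ⊥) ⟩
          (e ++ ⊥) ∪ (⊥ ++ image g Y)
            ≡⟨ ++⊥∪⊥++ e (image g Y) ⟩
          e ++ image g Y ∎

MonochromaticCopy : (r N : ℕ) → Colouring N → (Hyp → Set) → (Hyp → Set) → Set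
MonochromaticCopy r N c F₁ F₂ =
  (Σ[ H ∈ Hyp ] (F₁ H × Copy r N c true H)) ⊎ (Σ[ H ∈ Hyp ] (F₂ H × Copy r N c false H))

pool-extension : ∀ {r b s t m P} {c : Colouring (t + P)} {e : Subset t} {Q : Subset P} {F₁ : Hyp → Set} →
  b + ∣ e ∣ ≡ r → 0 < ∣ e ∣ → m ≤ ∣ Q ∣ → (∀ B → B ⊆ Q → ∣ B ∣ ≡ b → c (e ++ B) ≡ false) →
  Arrows r m F₁ (TK r (b + 1) s) → MonochromaticCopy r (t + P) c F₁ (TK r (b + 1) (suc s))
pool-extension {r} {b} {s} {t} {m} {P} {c} {e} {Q} {F₁} b+∣e∣≡r 0<∣e∣ m≤∣Q∣ blue arrows =
  [ inj₁ ∘ pull-back , inj₂ ∘ cone-off ]′ (arrows (c ∘ image q))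
  where
  open Enumeration (enumerate Q)

  g : Fin m → Fin P
  g x = element (inject≤ x m≤∣Q∣)

  g-injective : Injective _≡_ _≡_ g
  g-injective eq = inject≤-injective m≤∣Q∣ m≤∣Q∣ _ _ (injective eq)

  q : Fin m → Fin (t + P)
  q = (t ↑ʳ_) ∘ g

  blue-on-image : ∀ B → ∣ B ∣ ≡ b → c (e ++ image g B) ≡ false
  blue-on-image B ∣B∣≡b = blue (image g B) image⊆Q (trans (∣image∣≡∣e∣ g-injective B) ∣B∣≡b)
    where
    image⊆Q : image g B ⊆ Q
    image⊆Q y∈ = let (x , _ , gx≡y) = ∈-image⁻ g y∈ in subst (_∈ₛ Q) gx≡y (sound _)

  pull-back : Σ[ H ∈ Hyp ] (F₁ H × Copy r m (c ∘ image q) true H) →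
              Σ[ H ∈ Hyp ] (F₁ H × Copy r (t + P) c true H)
  pull-back (H , H∈F₁ , red) = H , H∈F₁ , Copy-pullback q (g-injective ∘ ↑ʳ-injective t _ _) red

  cone-off : Σ[ H ∈ Hyp ] (TK r (b + 1) s H × Copy r m (c ∘ image q) false H) →
             Σ[ H ∈ Hyp ] (TK r (b + 1) (suc s) H × Copy r (t + P) c false H)
  cone-off (H′ , H′∈TK , blue-H′) =
    cone , cone-TK b+∣e∣≡r (proj₂ (0<∣p∣⇒Nonempty 0<∣e∣)) ,
    cone-Copy b+∣e∣≡r g g-injective blue-on-image blue-H′
    where open Cone H′ H′∈TK e

arrows-step : ∀ {r k b t s m P} → 0 < k → k + b ≡ r → m + b * (t C k) ≤ b + P →
  Arrows r m (HK r k t) (TK r (b + 1) s) → Arrows r (t + P) (HK r k t) (TK r (b + 1) (suc s))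
arrows-step {r} {k} {b} {t} {s} {m} {P} 0<k k+b≡r room arrows c =
  [ blocked , inj₁ ∘ expansion ]′ (greedy b m (length es) χ ⊤ room′)
  where
  es = E (K k t)

  χ : Fin (length es) → Subset P → Bool
  χ i B = c (List.lookup es i ++ B)

  room′ : m + b * length es ≤ b + ∣ ⊤ {P} ∣
  room′ = subst₂ (λ L p → m + b * L ≤ b + p) (sym (length-E-K k t)) (sym (∣⊤∣≡n P)) room

  r∸k≡b : r ∸ k ≡ b
  r∸k≡b = trans (cong (_∸ k) (sym k+b≡r)) (m+n∸m≡n k b)

  expansion : DisjointChoice b χ ⊤ → Σ[ H ∈ Hyp ] (HK r k t H × Copy r (t + P) c true H)
  expansion (U , U⊆ , ∣U∣≡b , disjoint , red) =
    _ , refl , expansion-copy es (subst (k ≤_) k+b≡r (m≤m+n k b)) (K-uniform k t)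
                              (U , U⊆ , (λ i → trans (∣U∣≡b i) (sym r∸k≡b)) , disjoint , red)

  blocked : Blocked b m χ → MonochromaticCopy r (t + P) c (HK r k t) (TK r (b + 1) (suc s))
  blocked (i , Q , m≤∣Q∣ , blue) =
    pool-extension b+∣e∣≡r (subst (0 <_) (sym ∣e∣≡k) 0<k) m≤∣Q∣ blue arrows
    where
    ∣e∣≡k : ∣ List.lookup es i ∣ ≡ k
    ∣e∣≡k = ∈-K⁻ {n = t} (∈ₗ.∈-lookup i)
    b+∣e∣≡r : b + ∣ List.lookup es i ∣ ≡ r
    b+∣e∣≡r = trans (cong (b +_) ∣e∣≡k) (trans (+-comm b k) k+b≡r)

-- Only the Ramsey number m₂ enters the argument; m₁ ⊔ m₂ is merely an upper bound for it.
proposition4p8 : (a b t s : ℕ) → 1 ≤ a → 1 ≤ b → a + 2 ≤ t → b + 2 ≤ s →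
    (m₁ m₂ R : ℕ) →
    IsRamsey (a + b + 1) (HK (a + b + 1) (a + 1) (t ∸ 1)) (TK (a + b + 1) (b + 1) s) m₁ →
    IsRamsey (a + b + 1) (HK (a + b + 1) (a + 1) t) (TK (a + b + 1) (b + 1) (s ∸ 1)) m₂ →
    IsRamsey (a + b + 1) (HK (a + b + 1) (a + 1) t) (TK (a + b + 1) (b + 1) s) R →
    R ≤ (m₁ ⊔ m₂) + t + b * (t C (a + 1)) ∸ b
proposition4p8 a b t zero _ _ _ b+2≤0 _ _ _ _ _ _ = contradiction (≤-trans (m≤n+m 2 b) b+2≤0) λ ()
proposition4p8 a b t (suc s) _ _ a+2≤t _ m₁ m₂ R _ (m₂-arrows , _) (_ , R-least) = begin
  R                    ≤⟨ R-least (t + P) (arrows-step (m≤n+m 1 a) (a+1+b≡a+b+1 a b) room m₂-arrows) ⟩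
  t + P                ≡⟨ sym (+-∸-assoc t b≤M+bL) ⟩
  t + (M + b * L) ∸ b  ≡⟨ cong (_∸ b) (rearrange t M (b * L)) ⟩
  M + t + b * L ∸ b    ∎
  where
  open ≤-Reasoning
  M = m₁ ⊔ m₂
  L = t C (a + 1)
  P = M + b * L ∸ b

  b≤M+bL : b ≤ M + b * L
  b≤M+bL = ≤-trans (subst (_≤ b * L) (*-identityʳ b) (*-monoʳ-≤ b (C-positive a+1≤t))) (m≤n+m (b * L) M)
    where
    a+1≤t : a + 1 ≤ t
    a+1≤t = ≤-trans (+-monoʳ-≤ a (n≤1+n 1)) a+2≤t

  room : m₂ + b * L ≤ b + P
  room = ≤-trans (+-monoˡ-≤ (b * L) (m≤n⊔m m₁ m₂)) (m≤n+m∸n (M + b * L) b)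

  a+1+b≡a+b+1 : ∀ a b → a + 1 + b ≡ a + b + 1
  a+1+b≡a+b+1 = solve-∀

  rearrange : ∀ t M x → t + (M + x) ≡ M + t + x
  rearrange = solve-∀
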